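{- Let $A=(Ctrl,Sto,init,fin,\Rightarrow)$ and $A'=(Ctrl',Sto',init',fin',\Rightarrow')$ be automata, $L,R,J\subseteq(Ctrl\times Ctrl')\times(Sto\times Sto')$, and $\mathcal{Q},\mathcal{S}\subseteq Sto\times Sto'$. Suppose $\prod(A,A',L,R,J)$ is $\mathcal{Q}$-adequate. Then $\prod(A,A',L,R,J)\models\{\mathcal{Q}\}\{\mathcal{S}\}$ if and only if $A,A'\models\langle\mathcal{Q}\rangle\langle\mathcal{S}\rangle$.
   Context: An automaton is $(Ctrl,Sto,init,fin,\Rightarrow)$ with $Sto$ a set, $Ctrl$ a finite set containing distinct $init,fin$, and ${\Rightarrow}\subseteq(Ctrl\times Sto)\times(Ctrl\times Sto)$ such that $(n,s)\Rightarrow(m,t)$ implies $n\neq fin$ and $n\neq m$. The alignment automaton $\prod(A,A',L,R,J)$ is the automaton with control points $Ctrl\times Ctrl'$, stores $Sto\times Sto'$, initial point $(init,init')$, final point $(fin,fin')$, and $((n,n'),(s,s'))\Rightarrow((m,m'),(t,t'))$ iff one of: $((n,n'),(s,s'))\in L$, $(n,s)\Rightarrow(m,t)$ and $(n',s')=(m',t')$; or $((n,n'),(s,s'))\in R$, $(n,s)=(m,t)$ and $(n',s')\Rightarrow'(m',t')$; or $((n,n'),(s,s'))\in J$, $(n,s)\Rightarrow(m,t)$ and $(n',s')\Rightarrow'(m',t')$. The alignment automaton is $\mathcal{Q}$-adequate if for all $(s,s')\in\mathcal{Q}$ and all $t,t'$ with $(init,s)\Rightarrow^*(fin,t)$ and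 $(init',s')\Rightarrow'^*(fin',t')$ we have $((init,init'),(s,s'))\Rightarrow^*((fin,fin'),(t,t'))$. For an automaton $B$ with stores $Sto_B$ and $P,Q\subseteq Sto_B$, $B\models\{P\}\{Q\}$ means: whenever $(init_B,s)\Rightarrow^*(fin_B,t)$ and $s\in P$, then $t\in Q$. $A,A'\models\langle\mathcal{Q}\rangle\langle\mathcal{S}\rangle$ means: whenever $(init,s)\Rightarrow^*(fin,t)$, $(init',s')\Rightarrow'^*(fin',t')$ and $(s,s')\in\mathcal{Q}$, then $(t,t')\in\mathcal{S}$. -}

module Defs where

open import Level using (0ℓ)
open import Data.Nat using (ℕ)
open import Data.Fin using (Fin)
open import Data.Product using (Σ; _×_; _,_)
open import Data.Sum using (_⊎_)
open import Function.Bundles using (_↔_)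
open import Relation.Binary.PropositionalEquality using (_≡_; _≢_)
open import Relation.Binary.Construct.Closure.ReflexiveTransitive using (Star)

record Automaton : Set₁ where
  field
    Ctrl       : Set
    Sto        : Set
    ctrlFinite : Σ ℕ (λ k → Ctrl ↔ Fin k)
    init       : Ctrl
    fin        : Ctrl
    init≢fin   : init ≢ fin
    _⇒_        : Ctrl × Sto → Ctrl × Sto → Set
    ⇒-notFin   : ∀ {n s m t} → (n , s) ⇒ (m , t) → n ≢ fin
    ⇒-moves    : ∀ {n s m t} → (n , s) ⇒ (m , t) → n ≢ m

  _⇒*_ : Ctrl × Sto → Ctrl × Sto → Set
  _⇒*_ = Star _⇒_

open Automaton public

Pred : Set → Set₁
Pred X = X → Set

module _ (A A' : Automaton) where
  CC : Set
  CC = Ctrl A × Ctrl A'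
  SS : Set
  SS = Sto A × Sto A'

  data AlignStep (L R J : Pred (CC × SS)) : CC × SS → CC × SS → Set where
    stepL : ∀ {n n' s s' m t} → L ((n , n') , (s , s')) →
            _⇒_ A (n , s) (m , t) →
            AlignStep L R J ((n , n') , (s , s')) ((m , n') , (t , s'))
    stepR : ∀ {n n' s s' m' t'} → R ((n , n') , (s , s')) →
            _⇒_ A' (n' , s') (m' , t') →
            AlignStep L R J ((n , n') , (s , s')) ((n , m') , (s , t'))
    stepJ : ∀ {n n' s s' m m' t t'} → J ((n , n') , (s , s')) →
            _⇒_ A (n , s) (m , t) → _⇒_ A' (n' , s') (m' , t') →
            AlignStep L R J ((n , n') , (s , s')) ((m , m') , (t , t'))

  private
    open import Data.Fin using (combine; remQuot)
    open import Data.Fin.Properties using (remQuot-combine; combine-remQuot)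
    open import Data.Nat using (_*_)
    open import Function.Construct.Composition using (_↔-∘_)
    open import Data.Product.Function.NonDependent.Propositional using (_×-↔_)
    open import Function.Bundles using (mk↔ₛ′)
    open import Relation.Binary.PropositionalEquality using (refl; cong)

    finProd : ∀ a b → (Fin a × Fin b) ↔ Fin (a * b)
    finProd a b = mk↔ₛ′ (λ { (i , j) → combine i j }) (remQuot b)
      (λ k → combine-remQuot {a} b k) (λ { (i , j) → remQuot-combine i j })

  prodFinite : Σ ℕ (λ k → CC ↔ Fin k)
  prodFinite with ctrlFinite A | ctrlFinite A'
  ... | a , e | b , e' = (a * b) , (finProd a b ↔-∘ (e ×-↔ e'))

  private
    open import Relation.Binary.PropositionalEquality using (refl; cong)
    open import Data.Product using (proj₁; proj₂)

    align-notFin : ∀ {L R J n s m t} → AlignStep L R J (n , s) (m , t) →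
                   n ≢ (fin A , fin A')
    align-notFin (stepL _ st) eq = ⇒-notFin A st (cong proj₁ eq)
    align-notFin (stepR _ st) eq = ⇒-notFin A' st (cong proj₂ eq)
    align-notFin (stepJ _ st _) eq = ⇒-notFin A st (cong proj₁ eq)

    align-moves : ∀ {L R J n s m t} → AlignStep L R J (n , s) (m , t) → n ≢ m
    align-moves (stepL _ st) eq = ⇒-moves A st (cong proj₁ eq)
    align-moves (stepR _ st) eq = ⇒-moves A' st (cong proj₂ eq)
    align-moves (stepJ _ st _) eq = ⇒-moves A st (cong proj₁ eq)

  Align : (L R J : Pred (CC × SS)) → Automaton
  Align L R J = record
    { Ctrl = CC ; Sto = SS ; ctrlFinite = prodFinite
    ; init = (init A , init A') ; fin = (fin A , fin A')
    ; init≢fin = λ eq → init≢fin A (cong proj₁ eq)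
    ; _⇒_ = AlignStep L R J
    ; ⇒-notFin = align-notFin ; ⇒-moves = align-moves }

  Adequate : (L R J : Pred (CC × SS)) → Pred SS → Set
  Adequate L R J Q = ∀ s s' t t' → Q (s , s') →
    _⇒*_ A (init A , s) (fin A , t) → _⇒*_ A' (init A' , s') (fin A' , t') →
    _⇒*_ (Align L R J) ((init A , init A') , (s , s')) ((fin A , fin A') , (t , t'))

  RelValid : Pred SS → Pred SS → Set
  RelValid Q S = ∀ s s' t t' →
    _⇒*_ A (init A , s) (fin A , t) → _⇒*_ A' (init A' , s') (fin A' , t') →
    Q (s , s') → S (t , t')

HoareValid : (B : Automaton) → Pred (Sto B) → Pred (Sto B) → Set
HoareValid B P Q = ∀ s t → _⇒*_ B (init B , s) (fin B , t) → P s → Q t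

{-# OPTIONS --safe #-}
module Submission where

open import Defs
open import Data.Product using (_×_; _,_; proj₁; proj₂)
open import Function.Bundles using (_⇔_; mk⇔)
open import Relation.Binary.Construct.Closure.ReflexiveTransitive using (ε; _◅_)

-- Every run of the alignment automaton projects onto a run of each component;
-- adequacy is the converse for complete runs, so validity transfers both ways.

module _ (A A' : Automaton) {L R J : Pred (CC A A' × SS A A')} where

  align⇒*-proj : ∀ {n n' s s' m m' t t'} →
    _⇒*_ (Align A A' L R J) ((n , n') , (s , s')) ((m , m') , (t , t')) →
    _⇒*_ A (n , s) (m , t) × _⇒*_ A' (n' , s') (m' , t')
  align⇒*-proj ε = ε , ε
  align⇒*-proj (stepL _ step ◅ run) =
    let run₁ , run₂ = align⇒*-proj run in step ◅ run₁ , run₂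
  align⇒*-proj (stepR _ step' ◅ run) =
    let run₁ , run₂ = align⇒*-proj run in run₁ , step' ◅ run₂
  align⇒*-proj (stepJ _ step step' ◅ run) =
    let run₁ , run₂ = align⇒*-proj run in step ◅ run₁ , step' ◅ run₂

  relValid⇒hoareValid : ∀ {Q S} →
    RelValid A A' Q S → HoareValid (Align A A' L R J) Q S
  relValid⇒hoareValid valid (s , s') (t , t') run q =
    let run₁ , run₂ = align⇒*-proj run in valid s s' t t' run₁ run₂ q

  hoareValid⇒relValid : ∀ {Q S} → Adequate A A' L R J Q →
    HoareValid (Align A A' L R J) Q S → RelValid A A' Q S
  hoareValid⇒relValid adequate valid s s' t t' run₁ run₂ q =
    valid (s , s') (t , t') (adequate s s' t t' q run₁ run₂) q

proposition3p10 : (A A' : Automaton) (L R J : Pred (CC A A' × SS A A'))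
    (Q S : Pred (SS A A')) → Adequate A A' L R J Q →
    HoareValid (Align A A' L R J) Q S ⇔ RelValid A A' Q S
proposition3p10 A A' L R J Q S adequate =
  mk⇔ (hoareValid⇒relValid A A' adequate) (relValid⇒hoareValid A A')
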